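{- Let $G$ be a directed cycle of even length with vertex set $\{x_1,\dots,x_n\}$ and arcs $(x_j,x_{j+1})$ (indices modulo $n$), with a $c$-coloring $c$. Then $G$ has an up-color kernel if and only if one of the following holds: (1) $c(x_{2i})>c(x_{2i-1})$ for every $i$ (indices in $\mathbb{Z}_n$); or (2) $c(x_{2i+1})>c(x_{2i})$ for every $i$ (indices in $\mathbb{Z}_n$).
   Context: A $c$-coloring is a function $c:V\to\{0,1,2,\ldots\}$. A set $N$ of vertices is up-color absorbent if every vertex $x\notin N$ has an out-neighbor $y\in N$ with $c(x)<c(y)$, and no vertex of $N$ has color $0$. An up-color kernel is an independent up-color absorbent set. -}

module Defs where

open import Data.Nat using (ℕ; suc; _+_; _*_; _<_; NonZero)
open import Data.Nat.DivMod using (_mod_)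
open import Data.Fin using (Fin; toℕ)
open import Data.Fin.Subset using (Subset; _∈_; _∉_)
open import Data.Product using (∃-syntax; _×_)
open import Relation.Binary.PropositionalEquality using (_≡_)
open import Relation.Nullary using (¬_)

Digraph : ℕ → Set₁
Digraph n = Fin n → Fin n → Set

Coloring : ℕ → Set
Coloring n = Fin n → ℕ

Independent : ∀ {n} → Digraph n → Subset n → Set
Independent {n} G N = ∀ (x y : Fin n) → x ∈ N → y ∈ N → ¬ G x y

UpColorAbsorbent : ∀ {n} → Digraph n → Coloring n → Subset n → Set
UpColorAbsorbent {n} G c N =
  (∀ (x : Fin n) → x ∉ N → ∃[ y ] (y ∈ N × G x y × c x < c y))
  × (∀ (x : Fin n) → x ∈ N → ¬ (c x ≡ 0))

UpColorKernel : ∀ {n} → Digraph n → Coloring n → Subset n → Set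
UpColorKernel G c N = Independent G N × UpColorAbsorbent G c N

HasUpColorKernel : ∀ {n} → Digraph n → Coloring n → Set
HasUpColorKernel {n} G c = ∃[ N ] UpColorKernel {n} G c N

-- Vertex x_j (index taken modulo n), vertex set {x_0,...,x_{n-1}} = Fin n.
vx : ∀ n → .{{NonZero n}} → ℕ → Fin n
vx n j = j mod n

DirectedCycle : ∀ n → .{{NonZero n}} → Digraph n
DirectedCycle n x y = y ≡ vx n (suc (toℕ x))

{-# OPTIONS --safe #-}
-- In a directed cycle every vertex has exactly one out-neighbour, its successor, so a set N is an
-- up-color kernel iff membership alternates along the cycle and every arc leaving the complement of N
-- raises the color; the condition that N avoids color 0 comes for free, since each vertex of N is
-- entered by such an arc. Alternation forces N to be one of the two parity classes of the even cycle,
-- and conversely a parity class is a kernel exactly when all arcs leaving the other class rise.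
-- Conditions (1) and (2) say this for the odd and for the even vertices respectively.
module Submission where

open import Defs
open import Data.Bool.Properties using (T-≡)
open import Data.Empty using (⊥-elim)
open import Data.Fin using (Fin; toℕ)
open import Data.Fin.Properties using (fromℕ<-cong; fromℕ<-toℕ; toℕ-fromℕ<; toℕ<n)
open import Data.Fin.Subset using (Subset; _∈_; _∉_)
open import Data.Fin.Subset.Properties using (_∈?_)
open import Data.Nat.Base using (ℕ; zero; suc; _+_; _*_; _∸_; _<_; parity; ⌊_/2⌋; NonZero; _%_; _/_; z≤n; s≤s)
open import Data.Nat.DivMod using (m%n<n; m<n⇒m%n≡m; m%n%n≡m%n; [m+n]%n≡m%n; %-distribˡ-+; m≡m%n+[m/n]*n)
open import Data.Nat.Properties using (+-suc; *-suc; +-comm; +-identityʳ; +-∸-assoc; n≮0)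
open import Data.Parity.Base as ℙ using (Parity; 0ℙ; 1ℙ; _⁻¹)
import Data.Parity.Properties as ℙ
open import Data.Product using (∃-syntax; _,_)
open import Data.Sum using (_⊎_; inj₁; inj₂; [_,_])
open import Data.Sum.Function.Propositional using (_⊎-⇔_)
open import Data.Vec using (lookup; tabulate)
open import Data.Vec.Properties using (lookup∘tabulate; []=⇒lookup; lookup⇒[]=)
open import Function using (_∘_; const; id; case_of_)
open import Function.Bundles using (_⇔_; mk⇔; Equivalence)
open import Function.Construct.Composition using (_⇔-∘_)
open import Function.Construct.Symmetry using (⇔-sym)
open import Function.Related.TypeIsomorphisms using (¬-cong-⇔)
open import Function.Related.Propositional using (module EquationalReasoning)
open import Relation.Binary.PropositionalEquality using (_≡_; _≢_; refl; sym; trans; cong; subst; cong₂; module ≡-Reasoning)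
open import Relation.Nullary using (yes; no; isYes)
open import Relation.Nullary.Decidable using (toWitness; fromWitness)
open import Relation.Unary using (Pred; Decidable)
open import Level using (Level)

open Equivalence using (to; from)

private
  variable
    ℓ : Level
    n k : ℕ

parity-suc : ∀ j → parity (suc j) ≡ parity j ⁻¹
parity-suc zero = refl
parity-suc (suc zero) = refl
parity-suc (suc (suc j)) = parity-suc j

parity-+ : ∀ a b → parity (a + b) ≡ parity a ℙ.+ parity b
parity-+ zero b = refl
parity-+ (suc zero) b = parity-suc b
parity-+ (suc (suc a)) b = parity-+ a b

parity-* : ∀ a b → parity (a * b) ≡ parity a ℙ.* parity b
parity-* zero b = refl
parity-* (suc zero) b = cong parity (+-identityʳ b)
parity-* (suc (suc a)) b = begin
  parity (b + (b + a * b))                   ≡⟨ parity-+ b (b + a * b) ⟩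
  parity b ℙ.+ parity (b + a * b)            ≡⟨ cong (parity b ℙ.+_) (parity-+ b (a * b)) ⟩
  parity b ℙ.+ (parity b ℙ.+ parity (a * b)) ≡⟨ ℙ.+-assoc (parity b) (parity b) _ ⟨
  parity b ℙ.+ parity b ℙ.+ parity (a * b)   ≡⟨ cong (ℙ._+ parity (a * b)) (ℙ.p+p≡0ℙ (parity b)) ⟩
  parity (a * b)                             ≡⟨ parity-* a b ⟩
  parity a ℙ.* parity b                      ∎
  where open ≡-Reasoning

parity-% : ∀ j n .{{_ : NonZero n}} → parity n ≡ 0ℙ → parity (j % n) ≡ parity j
parity-% j n even = sym (begin
  parity j                                  ≡⟨ cong parity (m≡m%n+[m/n]*n j n) ⟩
  parity (j % n + j / n * n)                ≡⟨ parity-+ (j % n) (j / n * n) ⟩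
  parity (j % n) ℙ.+ parity (j / n * n)     ≡⟨ cong (parity (j % n) ℙ.+_) (parity-* (j / n) n) ⟩
  parity (j % n) ℙ.+ (parity (j / n) ℙ.* parity n)
    ≡⟨ cong (λ p → parity (j % n) ℙ.+ (parity (j / n) ℙ.* p)) even ⟩
  parity (j % n) ℙ.+ (parity (j / n) ℙ.* 0ℙ) ≡⟨ cong (parity (j % n) ℙ.+_) (ℙ.*-zeroʳ (parity (j / n))) ⟩
  parity (j % n) ℙ.+ 0ℙ                     ≡⟨ ℙ.+-identityʳ (parity (j % n)) ⟩
  parity (j % n)                            ∎)
  where open ≡-Reasoning

even⇒≡2*⌊/2⌋ : ∀ j → parity j ≡ 0ℙ → j ≡ 2 * ⌊ j /2⌋
even⇒≡2*⌊/2⌋ zero _ = refl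
even⇒≡2*⌊/2⌋ (suc (suc j)) even =
  trans (cong (suc ∘ suc) (even⇒≡2*⌊/2⌋ j even)) (sym (*-suc 2 ⌊ j /2⌋))

odd⇒≡1+2*⌊/2⌋ : ∀ j → parity j ≡ 1ℙ → j ≡ 1 + 2 * ⌊ j /2⌋
odd⇒≡1+2*⌊/2⌋ (suc zero) _ = refl
odd⇒≡1+2*⌊/2⌋ (suc (suc j)) odd =
  trans (cong (suc ∘ suc) (odd⇒≡1+2*⌊/2⌋ j odd)) (cong suc (sym (*-suc 2 ⌊ j /2⌋)))

p⁻¹≡q⇔p≢q : ∀ {p q} → p ⁻¹ ≡ q ⇔ p ≢ q
p⁻¹≡q⇔p≢q {p} = mk⇔ (λ { refl → ℙ.p≢p⁻¹ p }) (from′ p _)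
  where
  from′ : ∀ p q → p ≢ q → p ⁻¹ ≡ q
  from′ 0ℙ 0ℙ p≢q = ⊥-elim (p≢q refl)
  from′ 0ℙ 1ℙ _ = refl
  from′ 1ℙ 0ℙ _ = refl
  from′ 1ℙ 1ℙ p≢q = ⊥-elim (p≢q refl)

∃-Parity⇔⊎ : {P : Parity → Set} → (∃[ p ] P p) ⇔ (P 1ℙ ⊎ P 0ℙ)
∃-Parity⇔⊎ = mk⇔ (λ { (1ℙ , h) → inj₁ h ; (0ℙ , h) → inj₂ h }) [ (1ℙ ,_) , (0ℙ ,_) ]

subset : {P : Pred (Fin n) ℓ} → Decidable P → Subset n
subset P? = tabulate (isYes ∘ P?)

∈-subset : {P : Pred (Fin n) ℓ} (P? : Decidable P) {x : Fin n} → x ∈ subset P? ⇔ P x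
∈-subset P? {x} = mk⇔
  (λ x∈ → toWitness {a? = P? x} (T-≡ .from (trans (sym lookup-x) ([]=⇒lookup x∈))))
  (λ px → lookup⇒[]= x (subset P?) (trans lookup-x (T-≡ .to (fromWitness {a? = P? x} px))))
  where
  lookup-x : lookup (subset P?) x ≡ isYes (P? x)
  lookup-x = lookup∘tabulate (isYes ∘ P?) x

Successor : (Fin n → Fin n) → Digraph n
Successor s x y = y ≡ s x

record Alternating (s : Fin n → Fin n) (c : Coloring n) (N : Subset n) : Set where
  field
    ∈⇒succ∉  : ∀ x → x ∈ N → s x ∉ N
    ∉⇒succ∈  : ∀ x → x ∉ N → s x ∈ N
    ∉⇒rising : ∀ x → x ∉ N → c x < c (s x)

  succ∈⇔∉ : ∀ {x} → s x ∈ N ⇔ x ∉ N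
  succ∈⇔∉ {x} = mk⇔ (λ sx∈ x∈ → ∈⇒succ∉ x x∈ sx∈) (∉⇒succ∈ x)

upColorKernel⇔alternating : {s : Fin n → Fin n} {c : Coloring n} {N : Subset n} →
                            (∀ y → ∃[ x ] s x ≡ y) →
                            UpColorKernel (Successor s) c N ⇔ Alternating s c N
upColorKernel⇔alternating {n} {s} {c} {N} surjective = mk⇔ to′ from′
  where
  to′ : UpColorKernel (Successor s) c N → Alternating s c N
  to′ (independent , absorbent , _) = record
    { ∈⇒succ∉  = λ x x∈ sx∈ → independent x (s x) x∈ sx∈ refl
    ; ∉⇒succ∈  = λ x x∉ → case absorbent x x∉ of λ { (_ , y∈ , refl , _) → y∈ }
    ; ∉⇒rising = λ x x∉ → case absorbent x x∉ of λ { (_ , _ , refl , rising) → rising }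
    }
  from′ : Alternating s c N → UpColorKernel (Successor s) c N
  from′ alt = (λ { x _ x∈ y∈ refl → ∈⇒succ∉ x x∈ y∈ })
            , (λ x x∉ → s x , ∉⇒succ∈ x x∉ , refl , ∉⇒rising x x∉)
            , positive
    where
    open Alternating alt
    positive : ∀ y → y ∈ N → c y ≢ 0
    positive y y∈ with surjective y
    ... | x , refl = λ cy≡0 → n≮0 (subst (c x <_) cy≡0 (∉⇒rising x (λ x∈ → ∈⇒succ∉ x x∈ y∈)))

next : Fin (suc k) → Fin (suc k)
next {k} x = vx (suc k) (suc (toℕ x))

toℕ-vx : ∀ j → toℕ (vx (suc k) j) ≡ j % suc k
toℕ-vx {k} j = toℕ-fromℕ< (m%n<n j (suc k))

vx-cong-% : ∀ i j → i % suc k ≡ j % suc k → vx (suc k) i ≡ vx (suc k) j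
vx-cong-% {k} i j eq = fromℕ<-cong _ _ eq (m%n<n i (suc k)) (m%n<n j (suc k))

vx-toℕ : (x : Fin (suc k)) → vx (suc k) (toℕ x) ≡ x
vx-toℕ {k} x = trans (fromℕ<-cong _ _ (m<n⇒m%n≡m (toℕ<n x)) (m%n<n (toℕ x) (suc k)) (toℕ<n x))
                     (fromℕ<-toℕ x (toℕ<n x))

vx-periodic : ∀ j → vx (suc k) (j + suc k) ≡ vx (suc k) j
vx-periodic {k} j = vx-cong-% (j + suc k) j ([m+n]%n≡m%n j (suc k))

next-vx : ∀ j → next (vx (suc k) j) ≡ vx (suc k) (suc j)
next-vx {k} j = vx-cong-% (suc (toℕ (vx (suc k) j))) (suc j) (begin
  suc (toℕ (vx (suc k) j)) % suc k        ≡⟨ cong (λ i → suc i % suc k) (toℕ-vx j) ⟩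
  (1 + j % suc k) % suc k                  ≡⟨ %-distribˡ-+ 1 (j % suc k) (suc k) ⟩
  (1 % suc k + j % suc k % suc k) % suc k  ≡⟨ cong (λ i → (1 % suc k + i) % suc k) (m%n%n≡m%n j (suc k)) ⟩
  (1 % suc k + j % suc k) % suc k          ≡⟨ %-distribˡ-+ 1 j (suc k) ⟨
  suc j % suc k                            ∎)
  where open ≡-Reasoning

next-surjective : (y : Fin (suc k)) → ∃[ x ] next x ≡ y
next-surjective {k} y = vx (suc k) (toℕ y + k) , (begin
  next (vx (suc k) (toℕ y + k)) ≡⟨ next-vx (toℕ y + k) ⟩
  vx (suc k) (suc (toℕ y + k))  ≡⟨ cong (vx (suc k)) (+-suc (toℕ y) k) ⟨
  vx (suc k) (toℕ y + suc k)    ≡⟨ vx-periodic (toℕ y) ⟩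
  vx (suc k) (toℕ y)            ≡⟨ vx-toℕ y ⟩
  y                             ∎)
  where open ≡-Reasoning

parity-next : parity (suc k) ≡ 0ℙ → (x : Fin (suc k)) → parity (toℕ (next x)) ≡ parity (toℕ x) ⁻¹
parity-next {k} even x = begin
  parity (toℕ (next x))           ≡⟨ cong parity (toℕ-vx {k} (suc (toℕ x))) ⟩
  parity (suc (toℕ x) % suc k)    ≡⟨ parity-% (suc (toℕ x)) (suc k) even ⟩
  parity (suc (toℕ x))            ≡⟨ parity-suc (toℕ x) ⟩
  parity (toℕ x) ⁻¹               ∎
  where open ≡-Reasoning

parityClass : Parity → Subset (suc k)
parityClass p = subset (λ x → parity (toℕ x) ℙ.≟ p)

RisingAt : Coloring (suc k) → ℕ → Set
RisingAt {k} c j = c (vx (suc k) j) < c (vx (suc k) (suc j))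

RisingFrom : Coloring (suc k) → Parity → Set
RisingFrom c p = ∀ j → parity j ≡ p → RisingAt c j

parityClass-alternating : {c : Coloring (suc k)} {p : Parity} →
                          parity (suc k) ≡ 0ℙ → RisingFrom c p →
                          Alternating next c (parityClass (p ⁻¹))
parityClass-alternating {k} {c} {p} even rising = record
  { ∈⇒succ∉  = λ x x∈ nx∈ → p⁻¹≡q⇔p≢q .to (trans (sym (parity-next even x)) (∈-class .to nx∈)) (∈-class .to x∈)
  ; ∉⇒succ∈  = λ x x∉ → ∈-class .from (trans (parity-next even x) (flipped x x∉))
  ; ∉⇒rising = λ x x∉ → subst (λ y → c y < c (next x)) (vx-toℕ x)
                            (rising (toℕ x) (ℙ.⁻¹-injective (flipped x x∉)))
  }
  where
  ∈-class : ∀ {x} → x ∈ parityClass (p ⁻¹) ⇔ parity (toℕ x) ≡ p ⁻¹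
  ∈-class = ∈-subset (λ x → parity (toℕ x) ℙ.≟ p ⁻¹)
  flipped : ∀ x → x ∉ parityClass (p ⁻¹) → parity (toℕ x) ⁻¹ ≡ p ⁻¹
  flipped x x∉ = p⁻¹≡q⇔p≢q .from (x∉ ∘ ∈-class .from)

alternating⇒∈⇔parity : {c : Coloring (suc k)} {N : Subset (suc k)} {q : Parity} →
                       Alternating next c N → (vx (suc k) 0 ∈ N ⇔ 0ℙ ≡ q) →
                       ∀ j → vx (suc k) j ∈ N ⇔ parity j ≡ q
alternating⇒∈⇔parity alt base zero = base
alternating⇒∈⇔parity {k} {c} {N} {q} alt base (suc j) = begin
  vx (suc k) (suc j) ∈ N        ≡⟨ cong (_∈ N) (next-vx j) ⟨
  next (vx (suc k) j) ∈ N       ∼⟨ succ∈⇔∉ ⟩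
  vx (suc k) j ∉ N              ∼⟨ ¬-cong-⇔ (alternating⇒∈⇔parity alt base j) ⟩
  parity j ≢ q                  ∼⟨ ⇔-sym p⁻¹≡q⇔p≢q ⟩
  parity j ⁻¹ ≡ q               ≡⟨ cong (_≡ q) (parity-suc j) ⟨
  parity (suc j) ≡ q            ∎
  where
  open Alternating alt
  open EquationalReasoning

alternating⇒∃∈⇔parity : {c : Coloring (suc k)} {N : Subset (suc k)} →
                        Alternating next c N → ∃[ q ] ∀ j → vx (suc k) j ∈ N ⇔ parity j ≡ q
alternating⇒∃∈⇔parity {k} {N = N} alt with vx (suc k) 0 ∈? N
... | yes 0∈N = 0ℙ , alternating⇒∈⇔parity alt (mk⇔ (const refl) (const 0∈N))
... | no 0∉N  = 1ℙ , alternating⇒∈⇔parity alt (mk⇔ (⊥-elim ∘ 0∉N) (λ ()))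

upColorKernel⇒rising : {c : Coloring (suc k)} →
                       HasUpColorKernel (DirectedCycle (suc k)) c → ∃[ p ] RisingFrom c p
upColorKernel⇒rising {k} {c} (N , kernel) = complementRising (alternating⇒∃∈⇔parity alt)
  where
  alt : Alternating next c N
  alt = upColorKernel⇔alternating next-surjective .to kernel
  open Alternating alt
  complementRising : ∃[ q ] (∀ j → vx (suc k) j ∈ N ⇔ parity j ≡ q) → ∃[ p ] RisingFrom c p
  complementRising (q , ∈N⇔) = q ⁻¹ , λ j j-parity →
    subst (λ y → c (vx (suc k) j) < c y) (next-vx j)
      (∉⇒rising (vx (suc k) j) (λ j∈N → ℙ.p≢p⁻¹ q (trans (sym (∈N⇔ j .to j∈N)) j-parity)))

rising⇒upColorKernel : {c : Coloring (suc k)} → parity (suc k) ≡ 0ℙ →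
                       ∃[ p ] RisingFrom c p → HasUpColorKernel (DirectedCycle (suc k)) c
rising⇒upColorKernel even (p , rising) =
  parityClass (p ⁻¹) , upColorKernel⇔alternating next-surjective .from (parityClass-alternating even rising)

parity-2*+ : ∀ i j → parity (2 * i + j) ≡ parity j
parity-2*+ i j = trans (parity-+ (2 * i) j) (cong (ℙ._+ parity j) (parity-* 2 i))

RisingAt-periodic : (c : Coloring (suc k)) → ∀ j → RisingAt c (j + suc k) ≡ RisingAt c j
RisingAt-periodic c j = cong₂ (λ x y → c x < c y) (vx-periodic j) (vx-periodic (suc j))

RisingAt-2* : (c : Coloring (suc k)) → ∀ i →
              RisingAt c (2 * i) ≡ (c (vx (suc k) (2 * i)) < c (vx (suc k) (2 * i + 1)))
RisingAt-2* {k} c i = cong (λ j → c (vx (suc k) (2 * i)) < c (vx (suc k) j)) (+-comm 1 (2 * i))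

RisingAt-wraps : (c : Coloring (suc k)) → ∀ i →
                 RisingAt c (2 * i + k) ≡ (c (vx (suc k) (2 * i + suc k ∸ 1)) < c (vx (suc k) (2 * i)))
RisingAt-wraps {k} c i = cong₂ (λ j y → c (vx (suc k) j) < c y)
  (sym (+-∸-assoc (2 * i) (s≤s z≤n)))
  (trans (cong (vx (suc k)) (sym (+-suc (2 * i) k))) (vx-periodic (2 * i)))

rising0ℙ⇔ : {c : Coloring (suc k)} →
            RisingFrom c 0ℙ ⇔ (∀ i → c (vx (suc k) (2 * i)) < c (vx (suc k) (2 * i + 1)))
rising0ℙ⇔ {k} {c} = mk⇔
  (λ rising i → subst id (RisingAt-2* c i) (rising (2 * i) (parity-* 2 i)))
  (λ h j even → subst (RisingAt c) (sym (even⇒≡2*⌊/2⌋ j even))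
                  (subst id (sym (RisingAt-2* c ⌊ j /2⌋)) (h ⌊ j /2⌋)))

rising1ℙ⇔ : {c : Coloring (suc k)} → parity (suc k) ≡ 0ℙ →
            RisingFrom c 1ℙ ⇔ (∀ i → c (vx (suc k) (2 * i + suc k ∸ 1)) < c (vx (suc k) (2 * i)))
rising1ℙ⇔ {k} {c} even = mk⇔
  (λ rising i → subst id (RisingAt-wraps c i) (rising (2 * i + k) (trans (parity-2*+ i k) k-odd)))
  (λ h j odd → subst (RisingAt c) (sym (odd⇒≡1+2*⌊/2⌋ j odd)) (subst id (wrapped ⌊ j /2⌋) (h (suc ⌊ j /2⌋))))
  where
  open ≡-Reasoning
  k-odd : parity k ≡ 1ℙ
  k-odd = ℙ.⁻¹-injective (trans (sym (parity-suc k)) even)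
  wrapped : ∀ t → (c (vx (suc k) (2 * suc t + suc k ∸ 1)) < c (vx (suc k) (2 * suc t))) ≡ RisingAt c (1 + 2 * t)
  wrapped t = begin
    c (vx (suc k) (2 * suc t + suc k ∸ 1)) < c (vx (suc k) (2 * suc t)) ≡⟨ RisingAt-wraps c (suc t) ⟨
    RisingAt c (2 * suc t + k)         ≡⟨ cong (λ j → RisingAt c (j + k)) (*-suc 2 t) ⟩
    RisingAt c (suc (suc (2 * t + k))) ≡⟨ cong (RisingAt c ∘ suc) (+-suc (2 * t) k) ⟨
    RisingAt c (1 + 2 * t + suc k)     ≡⟨ RisingAt-periodic c (1 + 2 * t) ⟩
    RisingAt c (1 + 2 * t)             ∎

mainTheorem17 : (m : ℕ) → (c : Coloring (2 * suc m)) →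
    HasUpColorKernel (DirectedCycle (2 * suc m)) c
      ⇔ ((∀ (i : ℕ) → c (vx (2 * suc m) (2 * i + (2 * suc m) ∸ 1)) < c (vx (2 * suc m) (2 * i)))
         ⊎ (∀ (i : ℕ) → c (vx (2 * suc m) (2 * i)) < c (vx (2 * suc m) (2 * i + 1))))
mainTheorem17 m c =
  (rising1ℙ⇔ {c = c} even ⊎-⇔ rising0ℙ⇔ {c = c}) ⇔-∘
  (∃-Parity⇔⊎ ⇔-∘ mk⇔ upColorKernel⇒rising (rising⇒upColorKernel {c = c} even))
  where
  even : parity (2 * suc m) ≡ 0ℙ
  even = parity-* 2 (suc m)
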